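{- Let $n,\tau$ be positive integers with $\tau\ge\lceil 2n/3\rceil$, and let $\mathcal{D}_{n,\tau}$ be the set of connected graphs on $n$ vertices with dissociation number $\tau$. Then every graph in $\mathcal{D}_{n,\tau}$ with the minimum number of edges among all graphs in $\mathcal{D}_{n,\tau}$ is a tree.
   Context: A dissociation set of $G$ is a vertex set inducing a subgraph of maximum degree at most $1$; the dissociation number is the largest size of a dissociation set. -}

module Defs where

open import Data.Nat using (ℕ; zero; suc; _+_; _*_; _∸_; _≤_; _<ᵇ_)
open import Data.Nat.DivMod using (_/_)
open import Data.Bool using (Bool; true; false; _∧_; if_then_else_)
open import Data.Fin using (Fin; toℕ)
open import Data.Fin.Subset using (Subset; _∈_; _∩_; ∣_∣)
open import Data.Vec using (tabulate)
open import Data.Nat.ListAction using (sum)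
open import Data.List using (List; []; _∷_; map; allFin; length; head; last)
open import Data.List.Relation.Unary.Unique.Propositional using (Unique)
open import Data.Product using (Σ; _×_; ∃)
open import Data.Maybe using (Maybe; just; nothing)
open import Relation.Binary.PropositionalEquality using (_≡_)

record Graph (n : ℕ) : Set where
  field
    adj    : Fin n → Fin n → Bool
    sym    : ∀ i j → adj i j ≡ adj j i
    irrefl : ∀ i → adj i i ≡ false
open Graph public

Adj : ∀ {n} → Graph n → Fin n → Fin n → Set
Adj G i j = adj G i j ≡ true

edgeCount : ∀ {n} → Graph n → ℕ
edgeCount {n} G =
  sum (map (λ i → sum (map (λ j → if (toℕ i <ᵇ toℕ j) ∧ adj G i j then 1 else 0)
                           (allFin n)))
           (allFin n))

data Walk {n} (G : Graph n) : Fin n → Fin n → Set where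
  here : ∀ {u} → Walk G u u
  step : ∀ {u w v} → Adj G u w → Walk G w v → Walk G u v

Connected : ∀ {n} → Graph n → Set
Connected G = ∀ u v → Walk G u v

Path : ∀ {n} → Graph n → List (Fin n) → Set
Path G [] = Data.Unit.⊤ where import Data.Unit
Path G (x ∷ []) = Data.Unit.⊤ where import Data.Unit
Path G (x ∷ y ∷ xs) = Adj G x y × Path G (y ∷ xs)

IsCycle : ∀ {n} → Graph n → List (Fin n) → Set
IsCycle G vs =
  (3 ≤ length vs) × Unique vs × Path G vs ×
  Σ (Fin _) λ a → Σ (Fin _) λ b → (head vs ≡ just a) × (last vs ≡ just b) × Adj G b a

Acyclic : ∀ {n} → Graph n → Set
Acyclic G = ∀ vs → IsCycle G vs → Data.Empty.⊥ where import Data.Empty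

IsTree : ∀ {n} → Graph n → Set
IsTree G = Connected G × Acyclic G

N : ∀ {n} → Graph n → Fin n → Subset n
N G v = tabulate (adj G v)

IsDissociationSet : ∀ {n} → Graph n → Subset n → Set
IsDissociationSet G S = ∀ v → v ∈ S → ∣ N G v ∩ S ∣ ≤ 1

DissociationNumber : ∀ {n} → Graph n → ℕ → Set
DissociationNumber G τ =
  (Σ _ λ S → IsDissociationSet G S × ∣ S ∣ ≡ τ) ×
  (∀ S → IsDissociationSet G S → ∣ S ∣ ≤ τ)

⌈_/3⌉ : ℕ → ℕ
⌈ m /3⌉ = (m + 2) / 3

InD : (n τ : ℕ) → Graph n → Set
InD n τ G = Connected G × DissociationNumber G τ

-- If τ = n the whole vertex set is a dissociation set, so G has maximum degree
-- at most 1 and contains no cycle. Otherwise put s = n − τ, so that 3s ≤ n. The tree on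
-- 0, …, n − 1 in which every centre c < s hangs from 0 and every b ≥ s hangs from the centre
-- b mod s lies in 𝒟_{n,τ}: its n − s non-centres are pairwise non-adjacent, and a dissociation
-- set misses one of c, c + s, c + 2s for each centre c, hence misses at least s vertices.
-- A minimum graph therefore has at most n − 1 edges. But a connected graph containing a cycle
-- has at least n edges: the vertices of the cycle, inserted one after the other, span as many
-- edges as vertices, and adding the remaining vertices one at a time along edges of a walk
-- preserves that.

module Submission where

open import Defs hiding (sym)
open import Data.Bool using (Bool; true; false; not; _∧_; _∨_; if_then_else_)
open import Data.Bool.Properties using (∧-zeroʳ; ∧-identityʳ; ∨-identityʳ; ∨-zeroʳ; ¬-not)
import Data.Bool.Properties as Bool
open import Data.Empty using (⊥; ⊥-elim)
open import Data.Fin using (Fin; zero; suc; toℕ; fromℕ<)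
open import Data.Fin.Properties using (_≟_; toℕ-injective; toℕ<n; toℕ-fromℕ<; any?)
open import Data.Fin.Subset using (Subset; _∈_; _∩_; ∁; ⊤; ∣_∣)
open import Data.Fin.Subset.Properties using (∈⊤; ∣p∣≡n⇒p≡⊤; ∣p∣≤n; ∣∁p∣≡n∸∣p∣; x∉p⇒x∈∁p; _∈?_)
open import Data.List using ([]; _∷_; map; tabulate; allFin; last)
open import Data.List.Relation.Unary.All as All using (All; []; _∷_)
open import Data.List.Relation.Unary.AllPairs using (_∷_)
open import Data.List.Relation.Unary.Unique.Propositional using (Unique)
open import Data.Maybe using (just)
open import Data.Nat
  using (ℕ; zero; suc; _+_; _*_; _∸_; _≤_; _<_; _<ᵇ_; _≡ᵇ_; _%_; z≤n; s≤s; s≤s⁻¹; z<s; NonZero; >-nonZero⁻¹)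
import Data.Nat.ListAction as List
open import Data.Nat.DivMod using (m%n<n; [m+kn]%n≡m%n; m<n⇒m%n≡m; m≡m%n+[m/n]*n)
open import Data.Nat.Properties hiding (_≟_)
open import Algebra.Properties.CommutativeMonoid.Sum +-0-commutativeMonoid
  using (sum-syntax; ∑-distrib-+; ∑-comm; sum-cong-≗; sum-replicate-zero)
open import Data.Product using (_×_; ∃; ∃₂; _,_; uncurry)
open import Data.Sum using (_⊎_; inj₁; inj₂; [_,_]′)
open import Data.Vec as Vec using ([]; _∷_; lookup)
open import Data.Vec.Properties using (lookup∘tabulate; lookup-zipWith; lookup-map; []=⇒lookup; lookup⇒[]=)
open import Function using (_∘_)
open import Function.Bundles using (Equivalence)
open import Relation.Binary.Definitions using (tri<; tri≈; tri>)
open import Relation.Binary.PropositionalEquality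
open import Relation.Nullary using (¬_; yes; no; does; contradiction)
open import Relation.Nullary.Decidable using (dec-true; dec-false)

𝟙 : Bool → ℕ
𝟙 b = if b then 1 else 0

𝟙≤1 : ∀ b → 𝟙 b ≤ 1
𝟙≤1 true  = ≤-refl
𝟙≤1 false = z≤n

𝟙-∧≤ʳ : ∀ a b → 𝟙 (a ∧ b) ≤ 𝟙 b
𝟙-∧≤ʳ true  b = ≤-refl
𝟙-∧≤ʳ false b = z≤n

𝟙-∧-true : ∀ {a b} → a ≡ true → b ≡ true → 𝟙 (a ∧ b) ≡ 1
𝟙-∧-true refl refl = refl

sum-map-tabulate : ∀ {A : Set} {n} (f : A → ℕ) (g : Fin n → A) →
                   List.sum (map f (tabulate g)) ≡ ∑[ i < n ] f (g i)
sum-map-tabulate {n = zero}  f g = refl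
sum-map-tabulate {n = suc n} f g = cong (f (g zero) +_) (sum-map-tabulate f (g ∘ suc))

∑1≡n : ∀ n → ∑[ i < n ] 1 ≡ n
∑1≡n zero    = refl
∑1≡n (suc n) = cong suc (∑1≡n n)

∑-mono-≤ : ∀ {n} {f g : Fin n → ℕ} → (∀ i → f i ≤ g i) → ∑[ i < n ] f i ≤ ∑[ i < n ] g i
∑-mono-≤ {zero}  f≤g = z≤n
∑-mono-≤ {suc n} f≤g = +-mono-≤ (f≤g zero) (∑-mono-≤ (f≤g ∘ suc))

term≤∑ : ∀ {n} (f : Fin n → ℕ) i → f i ≤ ∑[ j < n ] f j
term≤∑ f zero    = m≤m+n _ _
term≤∑ f (suc i) = ≤-trans (term≤∑ (f ∘ suc) i) (m≤n+m _ _)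

two-terms≤∑ : ∀ {n} (f : Fin n → ℕ) {i j} → i ≢ j → f i + f j ≤ ∑[ k < n ] f k
two-terms≤∑ f {zero}  {zero}  i≢j = contradiction refl i≢j
two-terms≤∑ f {zero}  {suc j} _   = +-monoʳ-≤ (f zero) (term≤∑ (f ∘ suc) j)
two-terms≤∑ f {suc i} {zero}  _   =
  ≤-trans (≤-reflexive (+-comm (f (suc i)) (f zero))) (+-monoʳ-≤ (f zero) (term≤∑ (f ∘ suc) i))
two-terms≤∑ f {suc i} {suc j} i≢j =
  ≤-trans (two-terms≤∑ (f ∘ suc) (i≢j ∘ cong suc)) (m≤n+m _ _)

pointAt : ∀ {n} → Fin n → ℕ → Fin n → ℕ
pointAt y x i = if does (i ≟ y) then x else 0

∑-pointAt : ∀ {n} (y : Fin n) x → ∑[ i < n ] pointAt y x i ≡ x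
∑-pointAt {suc n} zero    x = trans (cong (x +_) (sum-replicate-zero n)) (+-identityʳ x)
∑-pointAt {suc n} (suc y) x = ∑-pointAt y x

pointAt-diag : ∀ {n} (y : Fin n) x → pointAt y x y ≡ x
pointAt-diag zero    x = refl
pointAt-diag (suc y) x = pointAt-diag y x

<⇒<ᵇ≡true : ∀ {m n} → m < n → (m <ᵇ n) ≡ true
<⇒<ᵇ≡true m<n = Equivalence.to Bool.T-≡ (<⇒<ᵇ m<n)

<ᵇ≡true⇒< : ∀ {m n} → (m <ᵇ n) ≡ true → m < n
<ᵇ≡true⇒< {m} {n} m<ᵇn = <ᵇ⇒< m n (Equivalence.from Bool.T-≡ m<ᵇn)

≮⇒<ᵇ≡false : ∀ {m n} → ¬ m < n → (m <ᵇ n) ≡ false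
≮⇒<ᵇ≡false m≮n = ¬-not (m≮n ∘ <ᵇ≡true⇒<)

∣p∣≡∑ : ∀ {n} (p : Subset n) → ∣ p ∣ ≡ ∑[ i < n ] 𝟙 (lookup p i)
∣p∣≡∑ []            = refl
∣p∣≡∑ (true  ∷ p) = cong suc (∣p∣≡∑ p)
∣p∣≡∑ (false ∷ p) = ∣p∣≡∑ p

∑𝟙[i≡ᵇc]≤1 : ∀ n c → ∑[ i < n ] 𝟙 (toℕ i ≡ᵇ c) ≤ 1
∑𝟙[i≡ᵇc]≤1 zero    c       = z≤n
∑𝟙[i≡ᵇc]≤1 (suc n) zero    = ≤-reflexive (cong suc (sum-replicate-zero n))
∑𝟙[i≡ᵇc]≤1 (suc n) (suc c) = ∑𝟙[i≡ᵇc]≤1 n c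

∑𝟙[0<ᵇi]≡n∸1 : ∀ n → ∑[ j < n ] 𝟙 (0 <ᵇ toℕ j) ≡ n ∸ 1
∑𝟙[0<ᵇi]≡n∸1 zero    = refl
∑𝟙[0<ᵇi]≡n∸1 (suc n) = ∑1≡n n

∑𝟙[i<ᵇs]≡s : ∀ n s → s ≤ n → ∑[ i < n ] 𝟙 (toℕ i <ᵇ s) ≡ s
∑𝟙[i<ᵇs]≡s zero    zero    _         = refl
∑𝟙[i<ᵇs]≡s (suc n) zero    _         = sum-replicate-zero n
∑𝟙[i<ᵇs]≡s (suc n) (suc s) (s≤s s≤n) = cong suc (∑𝟙[i<ᵇs]≡s n s s≤n)

onto⇒≤∣p∣ : ∀ {m k} (p : Subset m) (g : Fin m → Fin k) → (∀ c → ∃ λ x → x ∈ p × g x ≡ c) → k ≤ ∣ p ∣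
onto⇒≤∣p∣ {m} {k} p g onto = begin
  k                                                      ≡⟨ ∑1≡n k ⟨
  ∑[ c < k ] 1                                           ≤⟨ ∑-mono-≤ hit ⟩
  ∑[ c < k ] ∑[ x < m ] pointAt (g x) (𝟙 (lookup p x)) c  ≡⟨ ∑-comm (λ c x → pointAt (g x) (𝟙 (lookup p x)) c) ⟩
  ∑[ x < m ] ∑[ c < k ] pointAt (g x) (𝟙 (lookup p x)) c  ≡⟨ sum-cong-≗ (λ x → ∑-pointAt (g x) (𝟙 (lookup p x))) ⟩
  ∑[ x < m ] 𝟙 (lookup p x)                              ≡⟨ ∣p∣≡∑ p ⟨
  ∣ p ∣                                                  ∎
  where
  open ≤-Reasoning
  hit : ∀ c → 1 ≤ ∑[ x < m ] pointAt (g x) (𝟙 (lookup p x)) c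
  hit c with x , x∈p , refl ← onto c =
    subst (_≤ ∑[ y < m ] pointAt (g y) (𝟙 (lookup p y)) (g x))
          (trans (pointAt-diag (g x) _) (cong 𝟙 ([]=⇒lookup x∈p)))
          (term≤∑ (λ x′ → pointAt (g x′) (𝟙 (lookup p x′)) (g x)) x)

Adj-sym : ∀ {n} (G : Graph n) {u v} → Adj G u v → Adj G v u
Adj-sym G {u} {v} u~v = trans (Graph.sym G v u) u~v

module _ {n} {G : Graph n} where

  _++ʷ_ : ∀ {u v w} → Walk G u v → Walk G v w → Walk G u w
  here          ++ʷ walk′ = walk′
  step u~v walk ++ʷ walk′ = step u~v (walk ++ʷ walk′)

  reverseʷ : ∀ {u v} → Walk G u v → Walk G v u
  reverseʷ here            = here
  reverseʷ (step u~v walk) = reverseʷ walk ++ʷ step (Adj-sym G u~v) here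

module _ {n} (G : Graph n) where

  degreeIn : (Fin n → Bool) → Fin n → ℕ
  degreeIn R v = ∑[ j < n ] 𝟙 (adj G v j ∧ R j)

  1≤degreeIn : ∀ {R v a} → R a ≡ true → Adj G v a → 1 ≤ degreeIn R v
  1≤degreeIn {R} {v} {a} Ra v~a =
    subst (_≤ degreeIn R v) (𝟙-∧-true v~a Ra) (term≤∑ (λ j → 𝟙 (adj G v j ∧ R j)) a)

  2≤degreeIn : ∀ {R v a b} → R a ≡ true → R b ≡ true → a ≢ b → Adj G v a → Adj G v b →
               2 ≤ degreeIn R v
  2≤degreeIn {R} {v} Ra Rb a≢b v~a v~b =
    subst₂ (λ x y → x + y ≤ degreeIn R v) (𝟙-∧-true v~a Ra) (𝟙-∧-true v~b Rb)
      (two-terms≤∑ (λ j → 𝟙 (adj G v j ∧ R j)) a≢b)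

  ∣N∩S∣≡degreeIn : ∀ v S → ∣ N G v ∩ S ∣ ≡ degreeIn (lookup S) v
  ∣N∩S∣≡degreeIn v S = trans (∣p∣≡∑ (N G v ∩ S)) (sum-cong-≗ λ i → cong 𝟙 (begin
    lookup (N G v ∩ S) i                   ≡⟨ lookup-zipWith _∧_ i (N G v) S ⟩
    lookup (N G v) i ∧ lookup S i          ≡⟨ cong (_∧ lookup S i) (lookup∘tabulate (adj G v) i) ⟩
    adj G v i ∧ lookup S i                 ∎))
    where open ≡-Reasoning

  dissociation-no-two-neighbours : ∀ {S v a b} → IsDissociationSet G S →
    v ∈ S → a ∈ S → b ∈ S → a ≢ b → Adj G v a → Adj G v b → ⊥
  dissociation-no-two-neighbours {S} {v} dS v∈S a∈S b∈S a≢b v~a v~b =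
    ≤⇒≯ (dS v v∈S) (subst (2 ≤_) (sym (∣N∩S∣≡degreeIn v S))
      (2≤degreeIn ([]=⇒lookup a∈S) ([]=⇒lookup b∈S) a≢b v~a v~b))

  independent⇒dissociation : ∀ {S} → (∀ {u v} → u ∈ S → v ∈ S → ¬ Adj G u v) → IsDissociationSet G S
  independent⇒dissociation {S} independent v v∈S = begin
    ∣ N G v ∩ S ∣                          ≡⟨ ∣N∩S∣≡degreeIn v S ⟩
    ∑[ i < n ] 𝟙 (adj G v i ∧ lookup S i)  ≡⟨ sum-cong-≗ no-edge ⟩
    ∑[ i < n ] 0                           ≡⟨ sum-replicate-zero n ⟩
    0                                      ≤⟨ z≤n ⟩
    1                                      ∎
    where
    open ≤-Reasoning
    no-edge : ∀ i → 𝟙 (adj G v i ∧ lookup S i) ≡ 0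
    no-edge i with lookup S i in i∈S | adj G v i in v~i
    ... | false | b     = cong 𝟙 (∧-zeroʳ b)
    ... | true  | false = refl
    ... | true  | true  = contradiction v~i (independent v∈S (lookup⇒[]= i S i∈S))

  ⊤-dissociation⇒acyclic : IsDissociationSet G ⊤ → Acyclic G
  ⊤-dissociation⇒acyclic _ [] (() , _)
  ⊤-dissociation⇒acyclic _ (_ ∷ []) (s≤s () , _)
  ⊤-dissociation⇒acyclic _ (_ ∷ _ ∷ []) (s≤s (s≤s ()) , _)
  ⊤-dissociation⇒acyclic dS (a ∷ x₁ ∷ x₂ ∷ _) (_ , ((_ ∷ a≢x₂ ∷ _) ∷ _) , (a~x₁ , x₁~x₂ , _) , _) =
    dissociation-no-two-neighbours dS ∈⊤ ∈⊤ ∈⊤ a≢x₂ (Adj-sym G a~x₁) x₁~x₂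

module Density {n} (G : Graph n) where

  isEdge : Fin n → Fin n → Bool
  isEdge i j = (toℕ i <ᵇ toℕ j) ∧ adj G i j

  size : (Fin n → Bool) → ℕ
  size R = ∑[ i < n ] 𝟙 (R i)

  edgesIn : (Fin n → Bool) → ℕ
  edgesIn R = ∑[ i < n ] ∑[ j < n ] 𝟙 ((R i ∧ R j) ∧ isEdge i j)

  insert : Fin n → (Fin n → Bool) → Fin n → Bool
  insert y R i = R i ∨ does (i ≟ y)

  edgeCount≡edgesIn-all : edgeCount G ≡ edgesIn (λ _ → true)
  edgeCount≡edgesIn-all = begin
    List.sum (map (λ i → List.sum (map (𝟙 ∘ isEdge i) (allFin n))) (allFin n))
      ≡⟨ sum-map-tabulate (λ i → List.sum (map (𝟙 ∘ isEdge i) (allFin n))) (λ i → i) ⟩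
    ∑[ i < n ] List.sum (map (𝟙 ∘ isEdge i) (allFin n))
      ≡⟨ sum-cong-≗ (λ i → sum-map-tabulate (𝟙 ∘ isEdge i) (λ j → j)) ⟩
    edgesIn (λ _ → true) ∎
    where open ≡-Reasoning

  edgesIn≤edgeCount : ∀ R → edgesIn R ≤ edgeCount G
  edgesIn≤edgeCount R = subst (edgesIn R ≤_) (sym edgeCount≡edgesIn-all)
    (∑-mono-≤ λ i → ∑-mono-≤ λ j → 𝟙-∧≤ʳ (R i ∧ R j) (isEdge i j))

  size≤n : ∀ R → size R ≤ n
  size≤n R = subst (size R ≤_) (∑1≡n n) (∑-mono-≤ (𝟙≤1 ∘ R))

  size-all : ∀ R → (∀ i → R i ≡ true) → size R ≡ n
  size-all R all = trans (sum-cong-≗ (cong 𝟙 ∘ all)) (∑1≡n n)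

  size-insert : ∀ R y → R y ≡ false → size (insert y R) ≡ suc (size R)
  size-insert R y Ry = begin
    size (insert y R)                           ≡⟨ sum-cong-≗ split ⟩
    ∑[ i < n ] (𝟙 (R i) + pointAt y 1 i)         ≡⟨ ∑-distrib-+ (𝟙 ∘ R) (pointAt y 1) ⟩
    size R + ∑[ i < n ] pointAt y 1 i            ≡⟨ cong (size R +_) (∑-pointAt y 1) ⟩
    size R + 1                                  ≡⟨ +-comm (size R) 1 ⟩
    suc (size R)                                ∎
    where
    open ≡-Reasoning
    split : ∀ i → 𝟙 (insert y R i) ≡ 𝟙 (R i) + pointAt y 1 i
    split i with i ≟ y
    ... | yes refl rewrite Ry = refl
    ... | no _     rewrite ∨-identityʳ (R i) = sym (+-identityʳ _)

  size<n : ∀ R y → R y ≡ false → size R < n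
  size<n R y Ry = subst (_≤ n) (size-insert R y Ry) (size≤n (insert y R))

  isEdge-both-ways : ∀ i j → 𝟙 (isEdge i j) + 𝟙 (isEdge j i) ≡ 𝟙 (adj G i j)
  isEdge-both-ways i j with <-cmp (toℕ i) (toℕ j)
  ... | tri< i<j _ j≮i rewrite <⇒<ᵇ≡true i<j | ≮⇒<ᵇ≡false j≮i = +-identityʳ _
  ... | tri> i≮j _ j<i rewrite ≮⇒<ᵇ≡false i≮j | <⇒<ᵇ≡true j<i = cong 𝟙 (Graph.sym G j i)
  ... | tri≈ _ i≡j _ with refl ← toℕ-injective i≡j
    rewrite irrefl G i | ∧-zeroʳ (toℕ i <ᵇ toℕ i) = refl

  edgesIn-insert : ∀ R y → R y ≡ false → edgesIn (insert y R) ≡ edgesIn R + degreeIn G R y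
  edgesIn-insert R y Ry = begin
    edgesIn (insert y R)
      ≡⟨ sum-cong-≗ (λ i → sum-cong-≗ (split i)) ⟩
    ∑[ i < n ] ∑[ j < n ] (inside i j + pointAt y (out j) i + pointAt y (inn i) j)
      ≡⟨ ∑∑-distrib-+ _ _ ⟩
    ∑[ i < n ] ∑[ j < n ] (inside i j + pointAt y (out j) i) + ∑[ i < n ] ∑[ j < n ] pointAt y (inn i) j
      ≡⟨ cong₂ _+_ (∑∑-distrib-+ _ _) (sum-cong-≗ (λ i → ∑-pointAt y (inn i))) ⟩
    edgesIn R + ∑[ i < n ] ∑[ j < n ] pointAt y (out j) i + ∑[ i < n ] inn i
      ≡⟨ cong (λ t → edgesIn R + t + ∑[ j < n ] inn j) (trans (∑-comm (λ i j → pointAt y (out j) i))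
                                             (sum-cong-≗ (λ j → ∑-pointAt y (out j)))) ⟩
    edgesIn R + ∑[ j < n ] out j + ∑[ j < n ] inn j
      ≡⟨ +-assoc (edgesIn R) _ _ ⟩
    edgesIn R + (∑[ j < n ] out j + ∑[ j < n ] inn j)
      ≡⟨ cong (edgesIn R +_) (trans (sym (∑-distrib-+ out inn)) (sum-cong-≗ out+inn)) ⟩
    edgesIn R + degreeIn G R y ∎
    where
    open ≡-Reasoning
    inside : Fin n → Fin n → ℕ
    inside i j = 𝟙 ((R i ∧ R j) ∧ isEdge i j)
    out inn : Fin n → ℕ
    out j = 𝟙 (R j ∧ isEdge y j)
    inn i = 𝟙 (R i ∧ isEdge i y)

    ∑∑-distrib-+ : ∀ (A B : Fin n → Fin n → ℕ) →
      ∑[ i < n ] ∑[ j < n ] (A i j + B i j) ≡ ∑[ i < n ] ∑[ j < n ] A i j + ∑[ i < n ] ∑[ j < n ] B i j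
    ∑∑-distrib-+ A B = trans (sum-cong-≗ (λ i → ∑-distrib-+ (A i) (B i)))
                               (∑-distrib-+ (λ i → ∑[ j < n ] A i j) (λ i → ∑[ j < n ] B i j))

    split : ∀ i j → 𝟙 ((insert y R i ∧ insert y R j) ∧ isEdge i j)
                  ≡ inside i j + pointAt y (out j) i + pointAt y (inn i) j
    split i j with i ≟ y | j ≟ y
    ... | yes refl | yes refl rewrite Ry | irrefl G y | ∧-zeroʳ (toℕ y <ᵇ toℕ y) = refl
    ... | yes refl | no _     rewrite Ry | ∨-identityʳ (R j) = sym (+-identityʳ _)
    ... | no _     | yes refl rewrite Ry | ∨-identityʳ (R i) | ∧-identityʳ (R i) | ∧-zeroʳ (R i) = refl
    ... | no _     | no _     rewrite ∨-identityʳ (R i) | ∨-identityʳ (R j) =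
      sym (trans (+-identityʳ _) (+-identityʳ _))

    out+inn : ∀ j → out j + inn j ≡ 𝟙 (adj G y j ∧ R j)
    out+inn j with R j
    ... | true  = trans (isEdge-both-ways y j) (cong 𝟙 (sym (∧-identityʳ _)))
    ... | false = cong 𝟙 (sym (∧-zeroʳ _))

  Excess≤ : ℕ → (Fin n → Bool) → Set
  Excess≤ m R = size R ≤ edgesIn R + m

  insert-Excess≤ : ∀ {R y} m k → R y ≡ false → suc k ≤ degreeIn G R y →
                   Excess≤ (m + k) R → Excess≤ m (insert y R)
  insert-Excess≤ {R} {y} m k Ry k<degree excess = begin
    size (insert y R)                   ≡⟨ size-insert R y Ry ⟩
    suc (size R)                        ≤⟨ s≤s excess ⟩
    suc (edgesIn R + (m + k))           ≡⟨ cong suc (cong (edgesIn R +_) (+-comm m k)) ⟩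
    suc (edgesIn R + (k + m))           ≡⟨ sym (+-suc (edgesIn R) (k + m)) ⟩
    edgesIn R + (suc k + m)             ≤⟨ +-monoʳ-≤ (edgesIn R) (+-monoˡ-≤ m k<degree) ⟩
    edgesIn R + (degreeIn G R y + m)    ≡⟨ sym (+-assoc (edgesIn R) _ m) ⟩
    edgesIn R + degreeIn G R y + m      ≡⟨ cong (_+ m) (sym (edgesIn-insert R y Ry)) ⟩
    edgesIn (insert y R) + m            ∎
    where open ≤-Reasoning

  insert-self : ∀ R y → insert y R y ≡ true
  insert-self R y = trans (cong (R y ∨_) (dec-true (y ≟ y) refl)) (∨-zeroʳ (R y))

  insert-keeps : ∀ {R : Fin n → Bool} {y z} → R z ≡ true → insert y R z ≡ true
  insert-keeps {y = y} {z} Rz = cong (_∨ does (z ≟ y)) Rz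

  insert-∉ : ∀ {R : Fin n → Bool} {y z} → y ≢ z → R z ≡ false → insert y R z ≡ false
  insert-∉ {y = y} {z} y≢z Rz = cong₂ _∨_ Rz (dec-false (z ≟ y) (y≢z ∘ sym))

  insert-All∉ : ∀ {R : Fin n → Bool} {y zs} → All (y ≢_) zs → All (λ z → R z ≡ false) zs →
                All (λ z → insert y R z ≡ false) zs
  insert-All∉ {R} y≢zs Rzs = All.zipWith (uncurry (insert-∉ {R})) (y≢zs , Rzs)

  crossing-edge : ∀ {R : Fin n → Bool} {u w} → Walk G u w → R u ≡ true → R w ≡ false →
                  ∃₂ λ x y → R x ≡ true × R y ≡ false × Adj G y x
  crossing-edge here                  Ru Rw = ⊥-elim (Bool.not-¬ Ru Rw)
  crossing-edge {R} (step {w = v} u~v walk) Ru Rw with R v in Rv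
  ... | true  = crossing-edge walk Rv Rw
  ... | false = _ , v , Ru , Rv , Adj-sym G u~v

  connected-Excess≤0⇒n≤edgeCount : Connected G → ∀ {R a} → R a ≡ true → Excess≤ 0 R → n ≤ edgeCount G
  connected-Excess≤0⇒n≤edgeCount connected {R} {a} = grow n (m≤n+m n (size R))
    where
    grow : ∀ k {R} → n ≤ size R + k → R a ≡ true → Excess≤ 0 R → n ≤ edgeCount G
    grow k {R} n≤size+k Ra excess with any? (λ i → R i Bool.≟ false)
    ... | no ¬outside = begin
      n                  ≡⟨ sym (size-all R (λ i → ¬-not (¬outside ∘ (i ,_)))) ⟩
      size R             ≤⟨ excess ⟩
      edgesIn R + 0      ≡⟨ +-identityʳ _ ⟩
      edgesIn R          ≤⟨ edgesIn≤edgeCount R ⟩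
      edgeCount G        ∎
      where open ≤-Reasoning
    ... | yes (w , Rw) with crossing-edge (connected a w) Ra Rw | k
    ...   | _ , _ , _  , _  , _   | zero   =
      contradiction (subst (n ≤_) (+-identityʳ _) n≤size+k) (<⇒≱ (size<n R w Rw))
    ...   | _ , y , Rx , Ry , y~x | suc k′ =
      grow k′ (subst (n ≤_) (trans (+-suc (size R) k′) (cong (_+ k′) (sym (size-insert R y Ry)))) n≤size+k)
        (insert-keeps {R} Ra) (insert-Excess≤ 0 0 Ry (1≤degreeIn G Rx y~x) excess)

  -- Inserting the vertices of a cycle a, …, b in order keeps the excess at 1 until b, which
  -- is adjacent both to its predecessor and to a.
  close-cycle : ∀ R y ys {a u b} → R a ≡ true → R u ≡ true → u ≢ a →
    All (λ z → R z ≡ false) (y ∷ ys) → Unique (y ∷ ys) → Path G (u ∷ y ∷ ys) →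
    last (y ∷ ys) ≡ just b → Adj G b a → Excess≤ 1 R →
    ∃ λ R′ → R′ a ≡ true × Excess≤ 0 R′
  close-cycle R y [] Ra Ru u≢a (Ry ∷ []) _ (u~y , _) refl y~a excess =
    insert y R , insert-keeps {R} Ra ,
    insert-Excess≤ 0 1 Ry (2≤degreeIn G Ru Ra u≢a (Adj-sym G u~y) y~a) excess
  close-cycle R y (z ∷ zs) Ra Ru u≢a (Ry ∷ Rzs) (y≢zs ∷ unique) (u~y , path) last≡b b~a excess =
    close-cycle (insert y R) z zs (insert-keeps {R} Ra) (insert-self R y) y≢a
      (insert-All∉ {R} y≢zs Rzs) unique path last≡b b~a
      (insert-Excess≤ 1 0 Ry (1≤degreeIn G Ru (Adj-sym G u~y)) excess)
    where
    y≢a : y ≢ _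
    y≢a refl = Bool.not-¬ Ra Ry

  cycle⇒n≤edgeCount : Connected G → ∀ vs → IsCycle G vs → n ≤ edgeCount G
  cycle⇒n≤edgeCount _ [] (() , _)
  cycle⇒n≤edgeCount _ (_ ∷ []) (s≤s () , _)
  cycle⇒n≤edgeCount _ (_ ∷ _ ∷ []) (s≤s (s≤s ()) , _)
  cycle⇒n≤edgeCount connected (a ∷ x₁ ∷ x₂ ∷ rest)
    (_ , ((a≢x₁ ∷ a≢rest) ∷ x₁≢rest ∷ unique) , (a~x₁ , path) , _ , _ , refl , last≡b , b~a) =
    let _ , Ra , excess = close-cycle R₁ x₂ rest Ra₁ (insert-self R₀ x₁) (a≢x₁ ∘ sym)
                            rest∉R₁ unique path last≡b b~a excess₁
    in connected-Excess≤0⇒n≤edgeCount connected Ra excess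
    where
    ∅ R₀ R₁ : Fin n → Bool
    ∅ _ = false
    R₀ = insert a ∅
    R₁ = insert x₁ R₀

    Ra₁ : R₁ a ≡ true
    Ra₁ = insert-keeps {R₀} {x₁} {a} (insert-self ∅ a)

    rest∉R₁ : All (λ z → R₁ z ≡ false) (x₂ ∷ rest)
    rest∉R₁ = insert-All∉ {R₀} x₁≢rest (insert-All∉ {∅} a≢rest (All.universal (λ _ → refl) _))

    excess₀ : Excess≤ 1 R₀
    excess₀ = subst (_≤ edgesIn R₀ + 1) (sym (trans (size-insert ∅ a refl) (cong suc (sum-replicate-zero n))))
                (m≤n+m 1 (edgesIn R₀))

    excess₁ : Excess≤ 1 R₁
    excess₁ = insert-Excess≤ 1 0 (insert-∉ {∅} a≢x₁ refl)
                (1≤degreeIn G (insert-self ∅ a) (Adj-sym G a~x₁)) excess₀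

module ParentTree (n : ℕ) (parent : ℕ → ℕ) (parent-< : ∀ b → parent (suc b) < suc b) where

  -- The conjunct a <ᵇ b makes 0 the root, whatever the value of parent 0.
  isParentOf : ℕ → ℕ → Bool
  isParentOf a b = (a <ᵇ b) ∧ (a ≡ᵇ parent b)

  isParentOf-intro : ∀ {a b} → a < b → a ≡ parent b → isParentOf a b ≡ true
  isParentOf-intro {a} {b} a<b refl = cong₂ _∧_ (<⇒<ᵇ≡true a<b) (Equivalence.to (Bool.T-≡ {a ≡ᵇ a}) (≡⇒≡ᵇ a a refl))

  isParentOf-elim : ∀ a b → isParentOf a b ≡ true → a ≡ parent b
  isParentOf-elim a b isParent with a <ᵇ b
  ... | true = ≡ᵇ⇒≡ a (parent b) (Equivalence.from Bool.T-≡ isParent)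

  tree : Graph n
  tree = record
    { adj    = λ i j → isParentOf (toℕ i) (toℕ j) ∨ isParentOf (toℕ j) (toℕ i)
    ; sym    = λ i j → Bool.∨-comm (isParentOf (toℕ i) (toℕ j)) _
    ; irrefl = λ i → let isParent = toℕ i ≡ᵇ parent (toℕ i) in
                     cong (λ b → (b ∧ isParent) ∨ (b ∧ isParent)) (≮⇒<ᵇ≡false {toℕ i} (<-irrefl refl))
    }

  parent⇒Adj : ∀ {i j} → toℕ i < toℕ j → toℕ i ≡ parent (toℕ j) → Adj tree i j
  parent⇒Adj {i} {j} i<j i≡parent =
    cong (_∨ isParentOf (toℕ j) (toℕ i)) (isParentOf-intro i<j i≡parent)

  Adj⇒parent : ∀ {i j} → Adj tree i j → toℕ i ≡ parent (toℕ j) ⊎ toℕ j ≡ parent (toℕ i)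
  Adj⇒parent {i} {j} i~j with isParentOf (toℕ i) (toℕ j) in isParent
  ... | true  = inj₁ (isParentOf-elim _ _ isParent)
  ... | false = inj₂ (isParentOf-elim _ _ i~j)

  walk-to-root : ∀ k u r → toℕ u < k → toℕ r ≡ 0 → Walk tree u r
  walk-to-root (suc k) u r u<k r≡0 with toℕ u in u≡
  ... | zero  = subst (λ v → Walk tree v r) (toℕ-injective (trans r≡0 (sym u≡))) here
  ... | suc b = step (Adj-sym tree {q} {u} (parent⇒Adj (subst (toℕ q <_) (sym u≡) q<b) q≡parent))
                     (walk-to-root k q r (≤-trans q<b (s≤s⁻¹ u<k)) r≡0)
    where
    q : Fin n
    q = fromℕ< (<-trans (parent-< b) (subst (_< n) u≡ (toℕ<n u)))
    q≡parent : toℕ q ≡ parent (toℕ u)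
    q≡parent = trans (toℕ-fromℕ< _) (cong parent (sym u≡))
    q<b : toℕ q < suc b
    q<b = subst (_< suc b) (sym (toℕ-fromℕ< _)) (parent-< b)

  connected : Connected tree
  connected u v = walk-to-root n u r (toℕ<n u) r≡0 ++ʷ reverseʷ (walk-to-root n v r (toℕ<n v) r≡0)
    where
    r : Fin n
    r = fromℕ< (≤-trans (s≤s z≤n) (toℕ<n u))
    r≡0 : toℕ r ≡ 0
    r≡0 = toℕ-fromℕ< _

  edgeCount≤n∸1 : edgeCount tree ≤ n ∸ 1
  edgeCount≤n∸1 = begin
    edgeCount tree                            ≡⟨ edgeCount≡edgesIn-all ⟩
    ∑[ i < n ] ∑[ j < n ] 𝟙 (isEdge i j)       ≡⟨ ∑-comm (λ i j → 𝟙 (isEdge i j)) ⟩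
    ∑[ j < n ] ∑[ i < n ] 𝟙 (isEdge i j)       ≤⟨ ∑-mono-≤ column ⟩
    ∑[ j < n ] 𝟙 (0 <ᵇ toℕ j)                 ≡⟨ ∑𝟙[0<ᵇi]≡n∸1 n ⟩
    n ∸ 1                                     ∎
    where
    open ≤-Reasoning
    open Density tree using (isEdge; edgeCount≡edgesIn-all)

    isEdge≤isParentOf : ∀ i j → 𝟙 (isEdge i j) ≤ 𝟙 (isParentOf (toℕ i) (toℕ j))
    isEdge≤isParentOf i j with toℕ i <ᵇ toℕ j in i<ᵇj
    ... | false = z≤n
    ... | true rewrite ≮⇒<ᵇ≡false {toℕ j} {toℕ i} (<⇒≯ (<ᵇ≡true⇒< i<ᵇj))
                     | ∨-identityʳ (toℕ i ≡ᵇ parent (toℕ j)) = ≤-refl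

    column : ∀ j → ∑[ i < n ] 𝟙 (isEdge i j) ≤ 𝟙 (0 <ᵇ toℕ j)
    column j = ≤-trans (∑-mono-≤ (λ i → isEdge≤isParentOf i j)) (parents (toℕ j))
      where
      parents : ∀ b → ∑[ i < n ] 𝟙 (isParentOf (toℕ i) b) ≤ 𝟙 (0 <ᵇ b)
      parents zero    = ≤-reflexive (sum-replicate-zero n)
      parents (suc b) =
        ≤-trans (∑-mono-≤ {n} (λ i → 𝟙-∧≤ʳ (toℕ i <ᵇ suc b) (toℕ i ≡ᵇ parent (suc b)))) (∑𝟙[i≡ᵇc]≤1 n (parent (suc b)))

module ExtremalTree (n s : ℕ) .{{_ : NonZero s}} (3s≤n : 3 * s ≤ n) where

  parent : ℕ → ℕ
  parent b = if b <ᵇ s then 0 else b % s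

  parent<s : ∀ b → parent b < s
  parent<s b with b <ᵇ s
  ... | true  = >-nonZero⁻¹ s
  ... | false = m%n<n b s

  parent-< : ∀ b → parent (suc b) < suc b
  parent-< b with suc b <ᵇ s in b<ᵇs
  ... | true  = z<s
  ... | false = <-≤-trans (m%n<n (suc b) s) (≮⇒≥ λ b<s → Bool.not-¬ (<⇒<ᵇ≡true b<s) b<ᵇs)

  parent-child : ∀ c k → c < s → parent (c + suc k * s) ≡ c
  parent-child c k c<s with (c + suc k * s) <ᵇ s in child<ᵇs
  ... | true  = contradiction (<ᵇ≡true⇒< child<ᵇs)
                              (≤⇒≯ (≤-trans (m≤m+n s (k * s)) (m≤n+m _ c)))
  ... | false = trans ([m+kn]%n≡m%n c (suc k) s) (m<n⇒m%n≡m c<s)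

  open ParentTree n parent parent-< using (tree; edgeCount≤n∸1) public
  open ParentTree n parent parent-< using (connected; parent⇒Adj; Adj⇒parent)

  edge-meets-centre : ∀ {i j} → Adj tree i j → toℕ i < s ⊎ toℕ j < s
  edge-meets-centre i~j with Adj⇒parent i~j
  ... | inj₁ i≡parent = inj₁ (subst (_< s) (sym i≡parent) (parent<s _))
  ... | inj₂ j≡parent = inj₂ (subst (_< s) (sym j≡parent) (parent<s _))

  centres leaves : Subset n
  centres = Vec.tabulate (λ i → toℕ i <ᵇ s)
  leaves  = ∁ centres

  ∣leaves∣ : ∣ leaves ∣ ≡ n ∸ s
  ∣leaves∣ = trans (∣∁p∣≡n∸∣p∣ centres) (cong (n ∸_) ∣centres∣)
    where
    ∣centres∣ : ∣ centres ∣ ≡ s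
    ∣centres∣ = trans (∣p∣≡∑ centres)
      (trans (sum-cong-≗ {n} (cong 𝟙 ∘ lookup∘tabulate (λ i → toℕ i <ᵇ s))) (∑𝟙[i<ᵇs]≡s n s (≤-trans (m≤m+n s (2 * s)) 3s≤n)))

  leaf≮s : ∀ {v} → v ∈ leaves → ¬ toℕ v < s
  leaf≮s {v} v∈leaves v<s = Bool.not-¬ (<⇒<ᵇ≡true v<s) (begin
    toℕ v <ᵇ s                    ≡⟨ lookup∘tabulate _ v ⟨
    lookup centres v              ≡⟨ Bool.not-involutive _ ⟨
    not (not (lookup centres v))  ≡⟨ cong not (lookup-map v not centres) ⟨
    not (lookup leaves v)         ≡⟨ cong not ([]=⇒lookup v∈leaves) ⟩
    false                         ∎)
    where open ≡-Reasoning

  leaves-dissociation : IsDissociationSet tree leaves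
  leaves-dissociation = independent⇒dissociation tree λ u∈ v∈ u~v →
    [ leaf≮s u∈ , leaf≮s v∈ ]′ (edge-meets-centre u~v)

  classOf : Fin n → Fin s
  classOf x = fromℕ< (m%n<n (toℕ x) s)

  module Class (c : Fin s) where

    member : ∀ k → k ≤ 2 → Fin n
    member k k≤2 = fromℕ< (begin-strict
      toℕ c + k * s   <⟨ +-monoˡ-< (k * s) (toℕ<n c) ⟩
      suc k * s       ≤⟨ *-monoˡ-≤ s (s≤s k≤2) ⟩
      3 * s           ≤⟨ 3s≤n ⟩
      n               ∎)
      where open ≤-Reasoning

    toℕ-member : ∀ k k≤2 → toℕ (member k k≤2) ≡ toℕ c + k * s
    toℕ-member k k≤2 = toℕ-fromℕ< _

    classOf-member : ∀ k k≤2 → classOf (member k k≤2) ≡ c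
    classOf-member k k≤2 = toℕ-injective (begin
      toℕ (classOf (member k k≤2))   ≡⟨ toℕ-fromℕ< _ ⟩
      toℕ (member k k≤2) % s         ≡⟨ cong (_% s) (toℕ-member k k≤2) ⟩
      (toℕ c + k * s) % s            ≡⟨ [m+kn]%n≡m%n (toℕ c) k s ⟩
      toℕ c % s                      ≡⟨ m<n⇒m%n≡m (toℕ<n c) ⟩
      toℕ c                          ∎)
      where open ≡-Reasoning

    centre~child : ∀ k k<2 → Adj tree (member 0 z≤n) (member (suc k) k<2)
    centre~child k k<2 = parent⇒Adj
      (subst₂ _<_ (sym (trans (toℕ-member 0 z≤n) (+-identityʳ _))) (sym (toℕ-member (suc k) k<2))
              (m<m+n (toℕ c) (<-≤-trans (>-nonZero⁻¹ s) (m≤m+n s (k * s)))))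
      (trans (toℕ-member 0 z≤n)
             (trans (+-identityʳ _) (sym (trans (cong parent (toℕ-member (suc k) k<2))
                                                (parent-child (toℕ c) k (toℕ<n c))))))

    children-distinct : member 1 (s≤s z≤n) ≢ member 2 ≤-refl
    children-distinct same = <⇒≢ (+-monoʳ-< (toℕ c) (*-monoˡ-< s {1} {2} ≤-refl))
      (trans (sym (toℕ-member 1 (s≤s z≤n))) (trans (cong toℕ same) (toℕ-member 2 ≤-refl)))

    meets-∁ : ∀ S → IsDissociationSet tree S → ∃ λ x → x ∈ ∁ S × classOf x ≡ c
    meets-∁ S dS with member 0 z≤n ∈? S | member 1 (s≤s z≤n) ∈? S | member 2 ≤-refl ∈? S
    ... | no ∉S | _     | _     = _ , x∉p⇒x∈∁p ∉S , classOf-member 0 z≤n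
    ... | yes _ | no ∉S | _     = _ , x∉p⇒x∈∁p ∉S , classOf-member 1 (s≤s z≤n)
    ... | yes _ | yes _ | no ∉S = _ , x∉p⇒x∈∁p ∉S , classOf-member 2 ≤-refl
    ... | yes centre∈S | yes child₁∈S | yes child₂∈S = ⊥-elim
      (dissociation-no-two-neighbours tree dS centre∈S child₁∈S child₂∈S children-distinct
        (centre~child 0 (s≤s z≤n)) (centre~child 1 ≤-refl))

  dissociation≤n∸s : ∀ S → IsDissociationSet tree S → ∣ S ∣ ≤ n ∸ s
  dissociation≤n∸s S dS = m+n≤o⇒m≤o∸n ∣ S ∣ (begin
    ∣ S ∣ + s             ≤⟨ +-monoʳ-≤ ∣ S ∣ (onto⇒≤∣p∣ (∁ S) classOf (λ c → Class.meets-∁ c S dS)) ⟩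
    ∣ S ∣ + ∣ ∁ S ∣       ≡⟨ cong (∣ S ∣ +_) (∣∁p∣≡n∸∣p∣ S) ⟩
    ∣ S ∣ + (n ∸ ∣ S ∣)   ≡⟨ m+[n∸m]≡n (∣p∣≤n S) ⟩
    n                     ∎)
    where open ≤-Reasoning

  tree∈D : InD n (n ∸ s) tree
  tree∈D = connected , (leaves , leaves-dissociation , ∣leaves∣) , dissociation≤n∸s

⌈2n/3⌉≤τ⇒3[n∸τ]≤n : ∀ n τ → ⌈ 2 * n /3⌉ ≤ τ → 3 * (n ∸ τ) ≤ n
⌈2n/3⌉≤τ⇒3[n∸τ]≤n n τ ⌈2n/3⌉≤τ = begin
  3 * (n ∸ τ)     ≡⟨ *-distribˡ-∸ 3 n τ ⟩
  3 * n ∸ 3 * τ   ≤⟨ ∸-monoʳ-≤ (3 * n) 2n≤3τ ⟩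
  3 * n ∸ 2 * n   ≡⟨ m+n∸n≡m n (2 * n) ⟩
  n               ∎
  where
  open ≤-Reasoning
  2n≤3τ : 2 * n ≤ 3 * τ
  2n≤3τ = +-cancelʳ-≤ 2 (2 * n) (3 * τ) (begin
    2 * n + 2                                   ≡⟨ m≡m%n+[m/n]*n (2 * n + 2) 3 ⟩
    (2 * n + 2) % 3 + ⌈ 2 * n /3⌉ * 3           ≤⟨ +-mono-≤ (s≤s⁻¹ (m%n<n (2 * n + 2) 3)) (*-monoˡ-≤ 3 ⌈2n/3⌉≤τ) ⟩
    2 + τ * 3                                   ≡⟨ +-comm 2 (τ * 3) ⟩
    τ * 3 + 2                                   ≡⟨ cong (_+ 2) (*-comm τ 3) ⟩
    3 * τ + 2                                   ∎)

theorem4p3 : (n τ : ℕ) → 1 ≤ n → 1 ≤ τ → ⌈ 2 * n /3⌉ ≤ τ →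
    (G : Graph n) → InD n τ G →
    (∀ (H : Graph n) → InD n τ H → edgeCount G ≤ edgeCount H) →
    IsTree G
-- 1 ≤ τ follows from the other hypotheses, and of τ being the dissociation number of G only
-- the existence of S is used.
theorem4p3 n τ 1≤n _ ⌈2n/3⌉≤τ G (connected , (S , S-dissociation , ∣S∣≡τ) , _) minimal =
  connected , acyclic
  where
  τ≤n : τ ≤ n
  τ≤n = subst (_≤ n) ∣S∣≡τ (∣p∣≤n S)

  acyclic : Acyclic G
  acyclic with n ∸ τ in n∸τ≡s
  ... | zero = ⊤-dissociation⇒acyclic G (subst (IsDissociationSet G) (∣p∣≡n⇒p≡⊤ ∣S∣≡n) S-dissociation)
    where
    ∣S∣≡n : ∣ S ∣ ≡ n
    ∣S∣≡n = trans ∣S∣≡τ (≤-antisym τ≤n (m∸n≡0⇒m≤n n∸τ≡s))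
  ... | suc s-1 = λ vs cycle → <⇒≱ (∸-monoʳ-< z<s 1≤n) (begin
    n                ≤⟨ Density.cycle⇒n≤edgeCount G connected vs cycle ⟩
    edgeCount G      ≤⟨ minimal tree (subst (λ t → InD n t tree) n∸s≡τ tree∈D) ⟩
    edgeCount tree   ≤⟨ edgeCount≤n∸1 ⟩
    n ∸ 1            ∎)
    where
    open ≤-Reasoning
    open ExtremalTree n (suc s-1) (subst (λ t → 3 * t ≤ n) n∸τ≡s (⌈2n/3⌉≤τ⇒3[n∸τ]≤n n τ ⌈2n/3⌉≤τ))
      using (tree; tree∈D; edgeCount≤n∸1)
    n∸s≡τ : n ∸ suc s-1 ≡ τ
    n∸s≡τ = trans (cong (n ∸_) (sym n∸τ≡s)) (m∸[m∸n]≡n τ≤n)
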